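{- Let $k\geq 2$ be an integer. In the $(1:b)$ biased Maker–Breaker game on $E(K_n)$ with bias $b=\frac{2n}{k-1}$, Breaker has a strategy ensuring that, regardless of Maker's play, Maker's final graph $M$ satisfies $\Delta(M)<k$.
   Context: A $(1:b)$ biased Maker–Breaker game on $K_n$ is played on the board $E(K_n)$: in each round Maker claims one unclaimed edge and then Breaker claims $b$ unclaimed edges (fewer if fewer remain), until all edges are claimed. $M$ denotes the graph formed by Maker's edges at the end of the game, and $\Delta(M)$ its maximum degree. -}

module Defs where

open import Data.Nat using (ℕ; zero; suc; _≤_; _<_)
open import Data.Fin using (Fin) renaming (_<_ to _<ᶠ_)
import Data.Fin as F
open import Data.Bool using (Bool; true; false; if_then_else_; _∧_; _∨_)
open import Data.List using (List; length; filter; allFin)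
open import Data.Product using (Σ; _×_; _,_)
open import Data.Sum using (_⊎_)
open import Relation.Nullary using (Dec; yes; no; does; ¬_)
open import Relation.Binary.PropositionalEquality using (_≡_; refl; _≢_)

data Owner : Set where
  free maker breaker : Owner

_≟O_ : (x y : Owner) → Dec (x ≡ y)
free ≟O free = yes refl
free ≟O maker = no (λ ())
free ≟O breaker = no (λ ())
maker ≟O free = no (λ ())
maker ≟O maker = yes refl
maker ≟O breaker = no (λ ())
breaker ≟O free = no (λ ())
breaker ≟O maker = no (λ ())
breaker ≟O breaker = yes refl

-- Edges are the pairs u <ᶠ v; every claim updates both (u,v) and (v,u),
-- so the board is kept symmetric; diagonal entries stay free and are
-- never considered edges.
Board : ℕ → Set
Board n = Fin n → Fin n → Owner

emptyBoard : (n : ℕ) → Board n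
emptyBoard n _ _ = free

claim : {n : ℕ} → Owner → Fin n → Fin n → Board n → Board n
claim o u v B x y =
  if (does (x F.≟ u) ∧ does (y F.≟ v)) ∨ (does (x F.≟ v) ∧ does (y F.≟ u))
  then o else B x y

Full : {n : ℕ} → Board n → Set
Full {n} B = (u v : Fin n) → u <ᶠ v → B u v ≢ free

makerDeg : {n : ℕ} → Board n → Fin n → ℕ
makerDeg {n} B v = length (filter (λ u → B v u ≟O maker) (allFin n))

MaxDegLess : {n : ℕ} → ℕ → Board n → Set
MaxDegLess {n} k B = (v : Fin n) → makerDeg B v < k

data BreakerClaims {n : ℕ} : Board n → ℕ → Board n → Set where
  nil  : {B : Board n} → BreakerClaims B 0 B
  cons : {B B' : Board n} {m : ℕ} (u v : Fin n) → u <ᶠ v → B u v ≡ free →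
         BreakerClaims (claim breaker u v B) m B' → BreakerClaims B (suc m) B'

-- BreakerWins n k b B : from position B with Maker to move, in the (1:b)
-- game, Breaker has a strategy guaranteeing that at the end of the game
-- Maker's graph has maximum degree < k.  (Finite game: the inductive
-- alternating-quantifier definition is the existence of a winning strategy.)
data BreakerWins (n k b : ℕ) (B : Board n) : Set where
  done : Full B → MaxDegLess k B → BreakerWins n k b B
  step : Σ (Fin n) (λ u → Σ (Fin n) (λ v → u <ᶠ v × B u v ≡ free)) →
         ((u v : Fin n) → u <ᶠ v → B u v ≡ free →
           Σ ℕ (λ m → Σ (Board n) (λ B' →
             BreakerClaims (claim maker u v B) m B' ×
             m ≤ b × (m ≡ b ⊎ Full B') × BreakerWins n k b B'))) →
         BreakerWins n k b B

-- Take a = ⌊b/2⌋ and K = k − 1, so that n ≤ (a + 1) K.  Whenever Maker claims uv,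
-- Breaker claims up to a free edges at u, then up to a free edges at v, and spends
-- the rest of his b edges anywhere.  For every vertex x he thereby keeps
--   f(x) + (a + 1) d(x) ≤ n   unless x has no free edge left,
-- where f(x) is the free degree of x (loop included, so initially f(x) = n) and d(x)
-- its Maker degree: a Maker edge at x raises the left side by a, and Breaker's a edges
-- at x lower it back.  A Maker move at x needs f(x) ≥ 2, hence (a + 1) d(x) < n ≤ (a + 1) K,
-- so d(x) < K before the move and d(x) ≤ K < k after it.
module Submission where

open import Defs
open import Data.Nat using (ℕ; _≥_; _*_; _∸_)
open import Relation.Binary.PropositionalEquality using (_≡_)

open import Data.Nat using (zero; suc; _+_; _≤_; _<_; z≤n; s≤s; ⌊_/2⌋; ⌈_/2⌉)
open import Data.Nat.Properties
open import Data.Nat.Tactic.RingSolver using (solve-∀)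
open import Data.Fin as F using (Fin; zero; suc) renaming (_<_ to _<ᶠ_)
import Data.Fin.Properties as FP
open import Data.Vec.Functional using (foldr)
open import Data.Bool using (true; false; if_then_else_)
open import Data.List using (length; filter; tabulate)
open import Data.Product using (∃; _×_; _,_; proj₁)
open import Data.Sum as Sum using (_⊎_; inj₁; inj₂; [_,_])
open import Data.Unit using (⊤; tt)
open import Level using (0ℓ)
open import Function using (_∘_; id; const)
open import Relation.Nullary using (Dec; yes; no; does; ¬_; contradiction)
open import Relation.Nullary.Decidable using (_×-dec_; _⊎-dec_; dec-true; dec-false)
open import Relation.Binary using (Rel; Decidable; DecidableEquality; tri<; tri≈; tri>)
open import Relation.Binary.PropositionalEquality
  using (refl; sym; trans; cong; cong₂; subst; subst₂; _≢_; module ≡-Reasoning)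

module Counting {ℓ} {A : Set ℓ} (_≟_ : DecidableEquality A) where

  indicator : A → A → ℕ
  indicator x o = if does (x ≟ o) then 1 else 0

  indicator-refl : ∀ o → indicator o o ≡ 1
  indicator-refl o = cong (λ t → if t then 1 else 0) (dec-true (o ≟ o) refl)

  indicator-≢ : ∀ {x o} → x ≢ o → indicator x o ≡ 0
  indicator-≢ {x} {o} x≢o = cong (λ t → if t then 1 else 0) (dec-false (x ≟ o) x≢o)

  indicator≤1 : ∀ x o → indicator x o ≤ 1
  indicator≤1 x o with does (x ≟ o)
  ... | true  = ≤-refl
  ... | false = z≤n

  count : ∀ {n} → (Fin n → A) → A → ℕ
  count {zero}  r o = 0
  count {suc n} r o = indicator (r zero) o + count (r ∘ suc) o

  count-cong : ∀ {n} {r r′ : Fin n → A} o → (∀ y → r y ≡ r′ y) → count r o ≡ count r′ o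
  count-cong {zero}  o eq = refl
  count-cong {suc n} o eq = cong₂ _+_ (cong (λ x → indicator x o) (eq zero)) (count-cong o (eq ∘ suc))

  count-const : ∀ n o → count {n} (const o) o ≡ n
  count-const zero    o = refl
  count-const (suc n) o = cong₂ _+_ (indicator-refl o) (count-const n o)

  count-≡0 : ∀ {n} (r : Fin n → A) o → (∀ y → r y ≢ o) → count r o ≡ 0
  count-≡0 {zero}  r o none = refl
  count-≡0 {suc n} r o none
    rewrite indicator-≢ (none zero) = count-≡0 (r ∘ suc) o (none ∘ suc)

  -- Both indicators are added rather than subtracted, to avoid truncated subtraction.
  count-update : ∀ {n} (r r′ : Fin n → A) o (j : Fin n) → (∀ y → y ≢ j → r′ y ≡ r y) →
    count r′ o + indicator (r j) o ≡ count r o + indicator (r′ j) o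
  count-update r r′ o zero same = begin
    indicator (r′ zero) o + count (r′ ∘ suc) o + indicator (r zero) o
      ≡⟨ cong (λ c → indicator (r′ zero) o + c + indicator (r zero) o) rest-unchanged ⟩
    indicator (r′ zero) o + count (r ∘ suc) o + indicator (r zero) o
      ≡⟨ swap-ends (indicator (r′ zero) o) (count (r ∘ suc) o) (indicator (r zero) o) ⟩
    indicator (r zero) o + count (r ∘ suc) o + indicator (r′ zero) o ∎
    where
    open ≡-Reasoning
    rest-unchanged : count (r′ ∘ suc) o ≡ count (r ∘ suc) o
    rest-unchanged = count-cong o (λ y → same (suc y) (λ ()))
    swap-ends : ∀ x c y → x + c + y ≡ y + c + x
    swap-ends = solve-∀
  count-update r r′ o (suc j) same
    rewrite same zero (λ ())
          | +-assoc (indicator (r zero) o) (count (r′ ∘ suc) o) (indicator (r (suc j)) o)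
          | +-assoc (indicator (r zero) o) (count (r ∘ suc) o) (indicator (r′ (suc j)) o) =
    cong (indicator (r zero) o +_)
      (count-update (r ∘ suc) (r′ ∘ suc) o j (λ y y≢j → same (suc y) (y≢j ∘ FP.suc-injective)))

  count≥1 : ∀ {n} (r : Fin n → A) o i → r i ≡ o → 1 ≤ count r o
  count≥1 r o zero    ri≡o rewrite ri≡o | indicator-refl o = s≤s z≤n
  count≥1 r o (suc i) ri≡o = ≤-trans (count≥1 (r ∘ suc) o i ri≡o) (m≤n+m _ _)

  count≥2 : ∀ {n} (r : Fin n → A) o i j → i ≢ j → r i ≡ o → r j ≡ o → 2 ≤ count r o
  count≥2 r o zero    zero    i≢j _    _    = contradiction refl i≢j
  count≥2 r o zero    (suc j) _   ri≡o rj≡o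
    rewrite ri≡o | indicator-refl o = s≤s (count≥1 (r ∘ suc) o j rj≡o)
  count≥2 r o (suc i) zero    _   ri≡o rj≡o
    rewrite rj≡o | indicator-refl o = s≤s (count≥1 (r ∘ suc) o i ri≡o)
  count≥2 r o (suc i) (suc j) i≢j ri≡o rj≡o =
    ≤-trans (count≥2 (r ∘ suc) o i j (i≢j ∘ cong suc) ri≡o rj≡o) (m≤n+m _ _)

  count≤1 : ∀ {n} (r : Fin n → A) o (j : Fin n) → (∀ y → y ≢ j → r y ≢ o) → count r o ≤ 1
  count≤1 r o zero only
    rewrite count-≡0 (r ∘ suc) o (λ y → only (suc y) (λ ())) | +-identityʳ (indicator (r zero) o) =
    indicator≤1 (r zero) o
  count≤1 r o (suc j) only rewrite indicator-≢ (only zero (λ ())) =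
    count≤1 (r ∘ suc) o j (λ y y≢j → only (suc y) (y≢j ∘ FP.suc-injective))

  length-filter-tabulate : ∀ {n m} (g : Fin m → A) o (f : Fin n → Fin m) →
    length (filter (λ y → g y ≟ o) (tabulate f)) ≡ count (g ∘ f) o
  length-filter-tabulate {zero}  g o f = refl
  length-filter-tabulate {suc n} g o f with g (f zero) ≟ o
  ... | yes _ = cong suc (length-filter-tabulate g o (f ∘ suc))
  ... | no  _ = length-filter-tabulate g o (f ∘ suc)

open Counting _≟O_

sumᶠ : ∀ {n} → (Fin n → ℕ) → ℕ
sumᶠ = foldr _+_ 0

sumᶠ-mono-≤ : ∀ {n} {f g : Fin n → ℕ} → (∀ x → f x ≤ g x) → sumᶠ f ≤ sumᶠ g
sumᶠ-mono-≤ {zero}  f≤g = z≤n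
sumᶠ-mono-≤ {suc n} f≤g = +-mono-≤ (f≤g zero) (sumᶠ-mono-≤ (f≤g ∘ suc))

sumᶠ-mono-< : ∀ {n} {f g : Fin n → ℕ} (j : Fin n) → (∀ x → f x ≤ g x) → f j < g j → sumᶠ f < sumᶠ g
sumᶠ-mono-< zero    f≤g fj<gj = +-mono-<-≤ fj<gj (sumᶠ-mono-≤ (f≤g ∘ suc))
sumᶠ-mono-< (suc j) f≤g fj<gj = +-mono-≤-< (f≤g zero) (sumᶠ-mono-< j (f≤g ∘ suc) fj<gj)

SameEdge : ∀ {n} → Fin n → Fin n → Fin n → Fin n → Set
SameEdge u v x y = (x ≡ u × y ≡ v) ⊎ (x ≡ v × y ≡ u)

sameEdge? : ∀ {n} (u v x y : Fin n) → Dec (SameEdge u v x y)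
sameEdge? u v x y = ((x F.≟ u) ×-dec (y F.≟ v)) ⊎-dec ((x F.≟ v) ×-dec (y F.≟ u))

sameEdge-≢ : ∀ {n} {u v x y : Fin n} → u ≢ v → SameEdge u v x y → x ≢ y
sameEdge-≢ u≢v (inj₁ (refl , refl)) = u≢v
sameEdge-≢ u≢v (inj₂ (refl , refl)) = u≢v ∘ sym

sameEdge-functional : ∀ {n} {u v x y z : Fin n} → u ≢ v → SameEdge u v x y → SameEdge u v x z → y ≡ z
sameEdge-functional u≢v (inj₁ (refl , refl)) (inj₁ (_ , refl)) = refl
sameEdge-functional u≢v (inj₁ (refl , refl)) (inj₂ (u≡v , _)) = contradiction u≡v u≢v
sameEdge-functional u≢v (inj₂ (refl , refl)) (inj₁ (v≡u , _)) = contradiction (sym v≡u) u≢v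
sameEdge-functional u≢v (inj₂ (refl , refl)) (inj₂ (_ , refl)) = refl

Touches : ∀ {n} → Fin n → Fin n → Fin n → Set
Touches x u v = x ≡ u ⊎ x ≡ v

touches? : ∀ {n} (x u v : Fin n) → Dec (Touches x u v)
touches? x u v = (x F.≟ u) ⊎-dec (x F.≟ v)

partner : ∀ {n} {x u v : Fin n} → Touches x u v → ∃ λ y → SameEdge u v x y
partner {u = u} {v} (inj₁ x≡u) = v , inj₁ (x≡u , refl)
partner {u = u} {v} (inj₂ x≡v) = u , inj₂ (x≡v , refl)

claim-same : ∀ {n} o (u v : Fin n) B {x y} → SameEdge u v x y → claim o u v B x y ≡ o
claim-same o u v B {x} {y} e = cong (λ t → if t then o else B x y) (dec-true (sameEdge? u v x y) e)

claim-other : ∀ {n} o (u v : Fin n) B {x y} → ¬ SameEdge u v x y → claim o u v B x y ≡ B x y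
claim-other o u v B {x} {y} ¬e = cong (λ t → if t then o else B x y) (dec-false (sameEdge? u v x y) ¬e)

record WellFormed {n} (B : Board n) : Set where
  field
    symmetric     : ∀ x y → B x y ≡ B y x
    diagonal-free : ∀ x → B x x ≡ free
open WellFormed

sameEdge-owner : ∀ {n} {B : Board n} {u v x y} → WellFormed B → SameEdge u v x y → B x y ≡ B u v
sameEdge-owner wf (inj₁ (refl , refl)) = refl
sameEdge-owner wf (inj₂ (refl , refl)) = symmetric wf _ _

claim-wellFormed : ∀ {n} o {u v : Fin n} {B} → u ≢ v → WellFormed B → WellFormed (claim o u v B)
claim-wellFormed o {u} {v} {B} u≢v wf = record
  { symmetric     = symmetric′
  ; diagonal-free = λ x → trans (claim-other o u v B (λ e → sameEdge-≢ u≢v e refl)) (diagonal-free wf x)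
  }
  where
  flip : ∀ {x y} → SameEdge u v x y → SameEdge u v y x
  flip (inj₁ (x≡u , y≡v)) = inj₂ (y≡v , x≡u)
  flip (inj₂ (x≡v , y≡u)) = inj₁ (y≡u , x≡v)
  symmetric′ : ∀ x y → claim o u v B x y ≡ claim o u v B y x
  symmetric′ x y with sameEdge? u v x y
  ... | yes e = trans (claim-same o u v B e) (sym (claim-same o u v B (flip e)))
  ... | no ¬e =
    trans (claim-other o u v B ¬e) (trans (symmetric wf x y) (sym (claim-other o u v B (¬e ∘ flip))))

-- degree B free x counts the diagonal entry B x x, so it is one more than the number
-- of free edges at x.
degree : ∀ {n} → Board n → Owner → Fin n → ℕ
degree B o x = count (B x) o

degree-claim-endpoint : ∀ {n} o {u v x : Fin n} {B} → WellFormed B → u ≢ v → B u v ≡ free →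
  Touches x u v → ∀ c → degree (claim o u v B) c x + indicator free c ≡ degree B c x + indicator o c
degree-claim-endpoint o {u} {v} {x} {B} wf u≢v uv-free at c with partner at
... | y , e = begin
  degree B′ c x + indicator free c          ≡⟨ cong (λ w → degree B′ c x + indicator w c) xy-free ⟨
  degree B′ c x + indicator (B x y) c       ≡⟨ count-update (B x) (B′ x) c y others ⟩
  degree B c x + indicator (B′ x y) c       ≡⟨ cong (λ w → degree B c x + indicator w c) (claim-same o u v B e) ⟩
  degree B c x + indicator o c              ∎
  where
  open ≡-Reasoning
  B′ : Board _
  B′ = claim o u v B
  xy-free : B x y ≡ free
  xy-free = trans (sameEdge-owner wf e) uv-free
  others : ∀ z → z ≢ y → claim o u v B x z ≡ B x z
  others z z≢y = claim-other o u v B (z≢y ∘ sym ∘ sameEdge-functional u≢v e)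

degree-claim-elsewhere : ∀ {n} o {u v x : Fin n} {B} → ¬ Touches x u v → ∀ c →
  degree (claim o u v B) c x ≡ degree B c x
degree-claim-elsewhere o {u} {v} {x} {B} away c =
  count-cong c (λ y → claim-other o u v B {x} {y} [ away ∘ inj₁ ∘ proj₁ , away ∘ inj₂ ∘ proj₁ ])

free-degree≥2 : ∀ {n} {u v x : Fin n} {B} → WellFormed B → u ≢ v → B u v ≡ free →
  Touches x u v → 2 ≤ degree B free x
free-degree≥2 {x = x} {B} wf u≢v uv-free at with partner at
... | y , e =
  count≥2 (B x) free x y (sameEdge-≢ u≢v e) (diagonal-free wf x) (trans (sameEdge-owner wf e) uv-free)

no-free-edge-at⇒free-degree≤1 : ∀ {n} {B : Board n} x → WellFormed B →
  (∀ u v → u <ᶠ v → Touches x u v → B u v ≢ free) → degree B free x ≤ 1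
no-free-edge-at⇒free-degree≤1 {B = B} x wf none = count≤1 (B x) free x edge-not-free
  where
  edge-not-free : ∀ y → y ≢ x → B x y ≢ free
  edge-not-free y y≢x with FP.<-cmp x y
  ... | tri< x<y _ _ = none x y x<y (inj₁ refl)
  ... | tri≈ _ x≡y _ = contradiction (sym x≡y) y≢x
  ... | tri> _ _ y<x = none y x y<x (inj₂ refl) ∘ trans (symmetric wf y x)

record _⊑_ {n} (B B′ : Board n) : Set where
  field
    free-≤  : ∀ x → degree B′ free x ≤ degree B free x
    maker-≡ : ∀ x → degree B′ maker x ≡ degree B maker x
open _⊑_

⊑-refl : ∀ {n} {B : Board n} → B ⊑ B
⊑-refl = record { free-≤ = λ _ → ≤-refl ; maker-≡ = λ _ → refl }

⊑-trans : ∀ {n} {B₁ B₂ B₃ : Board n} → B₁ ⊑ B₂ → B₂ ⊑ B₃ → B₁ ⊑ B₃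
⊑-trans p q = record
  { free-≤  = λ x → ≤-trans (free-≤ q x) (free-≤ p x)
  ; maker-≡ = λ x → trans (maker-≡ q x) (maker-≡ p x)
  }

claim-free-degree : ∀ {n} {o} {u v x : Fin n} {B} → o ≢ free → WellFormed B → u ≢ v → B u v ≡ free →
  Touches x u v → degree (claim o u v B) free x + 1 ≡ degree B free x
claim-free-degree {o = o} {x = x} {B} o≢free wf u≢v uv-free at =
  trans (degree-claim-endpoint o wf u≢v uv-free at free)
        (trans (cong (degree B free x +_) (indicator-≢ o≢free)) (+-identityʳ _))

breakerClaim-⊑ : ∀ {n} {u v : Fin n} {B} → WellFormed B → u ≢ v → B u v ≡ free → B ⊑ claim breaker u v B
breakerClaim-⊑ {u = u} {v} {B} wf u≢v uv-free = record { free-≤ = free-≤′ ; maker-≡ = maker-≡′ }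
  where
  free-≤′ : ∀ x → degree (claim breaker u v B) free x ≤ degree B free x
  free-≤′ x with touches? x u v
  ... | yes at   = m+n≤o⇒m≤o _ (≤-reflexive (claim-free-degree (λ ()) wf u≢v uv-free at))
  ... | no  away = ≤-reflexive (degree-claim-elsewhere breaker {B = B} away free)
  maker-≡′ : ∀ x → degree (claim breaker u v B) maker x ≡ degree B maker x
  maker-≡′ x with touches? x u v
  ... | yes at   = +-cancelʳ-≡ 0 _ _ (degree-claim-endpoint breaker wf u≢v uv-free at maker)
  ... | no  away = degree-claim-elsewhere breaker {B = B} away maker

claims-++ : ∀ {n} {B₁ B₂ B₃ : Board n} {m₁ m₂} →
  BreakerClaims B₁ m₁ B₂ → BreakerClaims B₂ m₂ B₃ → BreakerClaims B₁ (m₁ + m₂) B₃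
claims-++ nil                  cs₂ = cs₂
claims-++ (cons u v u<v fr cs₁) cs₂ = cons u v u<v fr (claims-++ cs₁ cs₂)

claims-wellFormed : ∀ {n} {B B′ : Board n} {m} → WellFormed B → BreakerClaims B m B′ → WellFormed B′
claims-wellFormed wf nil                 = wf
claims-wellFormed wf (cons u v u<v _ cs) =
  claims-wellFormed (claim-wellFormed breaker (FP.<⇒≢ u<v) wf) cs

claims-⊑ : ∀ {n} {B B′ : Board n} {m} → WellFormed B → BreakerClaims B m B′ → B ⊑ B′
claims-⊑ wf nil                  = ⊑-refl
claims-⊑ wf (cons u v u<v fr cs) =
  ⊑-trans (breakerClaim-⊑ wf (FP.<⇒≢ u<v) fr) (claims-⊑ (claim-wellFormed breaker (FP.<⇒≢ u<v) wf) cs)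

AllClaims : ∀ {n} → Rel (Fin n) 0ℓ → ∀ {B B′ : Board n} {m} → BreakerClaims B m B′ → Set
AllClaims P nil                = ⊤
AllClaims P (cons u v _ _ cs) = P u v × AllClaims P cs

claims-at-free-degree : ∀ {n} {B B′ : Board n} {m} x → WellFormed B → (cs : BreakerClaims B m B′) →
  AllClaims (Touches x) cs → degree B′ free x + m ≡ degree B free x
claims-at-free-degree x wf nil tt = +-identityʳ _
claims-at-free-degree {B = B} {B′} {suc m} x wf (cons u v u<v fr cs) (at , rest) = begin
  degree B′ free x + suc m                    ≡⟨ +-suc _ m ⟩
  suc (degree B′ free x + m)                  ≡⟨ cong suc (claims-at-free-degree x wf′ cs rest) ⟩
  suc (degree (claim breaker u v B) free x)   ≡⟨ +-comm 1 _ ⟩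
  degree (claim breaker u v B) free x + 1     ≡⟨ claim-free-degree (λ ()) wf (FP.<⇒≢ u<v) fr at ⟩
  degree B free x                             ∎
  where
  open ≡-Reasoning
  wf′ : WellFormed (claim breaker u v B)
  wf′ = claim-wellFormed breaker (FP.<⇒≢ u<v) wf

record Greedy {n} (P : Rel (Fin n) 0ℓ) (c : ℕ) (B : Board n) : Set where
  field
    {claimed}     : ℕ
    {result}      : Board n
    claims        : BreakerClaims B claimed result
    within-budget : claimed ≤ c
    exhausted     : claimed ≡ c ⊎ (∀ u v → u <ᶠ v → P u v → result u v ≢ free)
    along         : AllClaims P claims
open Greedy

greedy : ∀ {n} (P : Rel (Fin n) 0ℓ) → Decidable P → ∀ c (B : Board n) → Greedy P c B
greedy P P? zero B = record { claims = nil ; within-budget = z≤n ; exhausted = inj₁ refl ; along = tt }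
greedy P P? (suc c) B with FP.any? (λ u → FP.any? (λ v → (u F.<? v) ×-dec P? u v ×-dec (B u v ≟O free)))
... | no none = record
  { claims        = nil
  ; within-budget = z≤n
  ; exhausted     = inj₂ (λ u v u<v p fr → none (u , v , u<v , p , fr))
  ; along         = tt
  }
... | yes (u , v , u<v , p , fr) = record
  { claims        = cons u v u<v fr (claims rest)
  ; within-budget = s≤s (within-budget rest)
  ; exhausted     = Sum.map₁ (cong suc) (exhausted rest)
  ; along         = p , along rest
  }
  where
  rest : Greedy P c (claim breaker u v B)
  rest = greedy P P? c (claim breaker u v B)

module BreakerStrategy (n a b K : ℕ) (a+a≤b : a + a ≤ b) (n≤[1+a]K : n ≤ suc a * K) where

  potential : Board n → Fin n → ℕ
  potential B x = degree B free x + suc a * degree B maker x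

  potential-⊑ : ∀ {B B′} → B ⊑ B′ → ∀ x → potential B′ x ≤ potential B x
  potential-⊑ ext x rewrite maker-≡ ext x = +-monoˡ-≤ _ (free-≤ ext x)

  Safe : Board n → Fin n → Set
  Safe B x = degree B free x ≤ 1 ⊎ potential B x ≤ n

  safe-⊑ : ∀ {B B′} → B ⊑ B′ → ∀ {x} → Safe B x → Safe B′ x
  safe-⊑ ext {x} = Sum.map (≤-trans (free-≤ ext x)) (≤-trans (potential-⊑ ext x))

  safe⇒maker<K : ∀ {B x} → Safe B x → 2 ≤ degree B free x → degree B maker x < K
  safe⇒maker<K (inj₁ f≤1) 2≤f = contradiction (≤-trans 2≤f f≤1) 1+n≰n
  safe⇒maker<K {B} {x} (inj₂ p≤n) 2≤f = *-cancelˡ-< (suc a) _ _ (begin-strict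
    suc a * degree B maker x      <⟨ m<n+m _ {2} (s≤s z≤n) ⟩
    2 + suc a * degree B maker x  ≤⟨ +-monoˡ-≤ _ 2≤f ⟩
    potential B x                 ≤⟨ p≤n ⟩
    n                             ≤⟨ n≤[1+a]K ⟩
    suc a * K                     ∎)
    where open ≤-Reasoning

  restore-safe : ∀ {B} x → WellFormed B → potential B x ≤ n + a →
    (g : Greedy (Touches x) a B) → Safe (result g) x
  restore-safe {B} x wf p≤n+a g with exhausted g
  ... | inj₂ none = inj₁ (no-free-edge-at⇒free-degree≤1 x (claims-wellFormed wf (claims g)) none)
  ... | inj₁ m≡a = inj₂ (+-cancelʳ-≤ a _ _ (begin
    potential B′ x + a
      ≡⟨ swap-last (degree B′ free x) (suc a * degree B′ maker x) a ⟩
    degree B′ free x + a + suc a * degree B′ maker x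
      ≡⟨ cong₂ (λ f M → f + suc a * M) free-drop (maker-≡ (claims-⊑ wf (claims g)) x) ⟩
    potential B x
      ≤⟨ p≤n+a ⟩
    n + a ∎))
    where
    open ≤-Reasoning
    B′ : Board n
    B′ = result g
    free-drop : degree B′ free x + a ≡ degree B free x
    free-drop =
      trans (cong (degree B′ free x +_) (sym m≡a)) (claims-at-free-degree x wf (claims g) (along g))
    swap-last : ∀ f p a → f + p + a ≡ f + a + p
    swap-last = solve-∀

  freeTotal : Board n → ℕ
  freeTotal B = sumᶠ (degree B free)

  record Invariant (B : Board n) : Set where
    field
      wellFormed : WellFormed B
      capped     : ∀ x → degree B maker x ≤ K
      safe       : ∀ x → Safe B x

  Reply : Board n → Board n → Set
  Reply B B₁ = ∃ λ m → ∃ λ B′ →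
    BreakerClaims B₁ m B′ × m ≤ b × (m ≡ b ⊎ Full B′) × Invariant B′ × freeTotal B′ < freeTotal B

  module MakerMove {B : Board n} (inv : Invariant B)
                   {u v : Fin n} (u<v : u <ᶠ v) (uv-free : B u v ≡ free) where
    open Invariant inv

    u≢v : u ≢ v
    u≢v = FP.<⇒≢ u<v

    B₁ : Board n
    B₁ = claim maker u v B

    wf₁ : WellFormed B₁
    wf₁ = claim-wellFormed maker u≢v wellFormed

    free-drop : ∀ {x} → Touches x u v → degree B₁ free x + 1 ≡ degree B free x
    free-drop = claim-free-degree (λ ()) wellFormed u≢v uv-free

    maker-rise : ∀ {x} → Touches x u v → degree B₁ maker x ≡ suc (degree B maker x)
    maker-rise at =
      trans (sym (+-identityʳ _))
            (trans (degree-claim-endpoint maker wellFormed u≢v uv-free at maker) (+-comm _ 1))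

    free-≤₁ : ∀ x → degree B₁ free x ≤ degree B free x
    free-≤₁ x with touches? x u v
    ... | yes at   = m+n≤o⇒m≤o _ (≤-reflexive (free-drop at))
    ... | no  away = ≤-reflexive (degree-claim-elsewhere maker {B = B} away free)

    capped₁ : ∀ x → degree B₁ maker x ≤ K
    capped₁ x with touches? x u v
    ... | yes at   = subst (_≤ K) (sym (maker-rise at))
                       (safe⇒maker<K {B} (safe x) (free-degree≥2 wellFormed u≢v uv-free at))
    ... | no  away = subst (_≤ K) (sym (degree-claim-elsewhere maker {B = B} away maker)) (capped x)

    endpoint-potential : ∀ {x} → Touches x u v → potential B₁ x ≤ n + a
    endpoint-potential {x} at with safe x
    ... | inj₁ f≤1 = contradiction (≤-trans (free-degree≥2 wellFormed u≢v uv-free at) f≤1) 1+n≰n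
    ... | inj₂ p≤n = begin
      potential B₁ x
        ≡⟨ cong (λ M → degree B₁ free x + suc a * M) (maker-rise at) ⟩
      degree B₁ free x + suc a * suc (degree B maker x)
        ≡⟨ shift (degree B₁ free x) a (degree B maker x) ⟩
      degree B₁ free x + 1 + suc a * degree B maker x + a
        ≡⟨ cong (λ f → f + suc a * degree B maker x + a) (free-drop at) ⟩
      potential B x + a
        ≤⟨ +-monoˡ-≤ a p≤n ⟩
      n + a ∎
      where
      open ≤-Reasoning
      shift : ∀ f a M → f + suc a * suc M ≡ f + 1 + suc a * M + a
      shift = solve-∀

    safe-elsewhere : ∀ {x} → ¬ Touches x u v → Safe B₁ x
    safe-elsewhere {x} away =
      subst₂ (λ f M → f ≤ 1 ⊎ f + suc a * M ≤ n)
        (sym (degree-claim-elsewhere maker {B = B} away free))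
        (sym (degree-claim-elsewhere maker {B = B} away maker))
        (safe x)

    atU : Greedy (Touches u) a B₁
    atU = greedy (Touches u) (touches? u) a B₁

    B₂ : Board n
    B₂ = result atU

    wf₂ : WellFormed B₂
    wf₂ = claims-wellFormed wf₁ (claims atU)

    atV : Greedy (Touches v) a B₂
    atV = greedy (Touches v) (touches? v) a B₂

    B₃ : Board n
    B₃ = result atV

    wf₃ : WellFormed B₃
    wf₃ = claims-wellFormed wf₂ (claims atV)

    spent : ℕ
    spent = claimed atU + claimed atV

    spent≤b : spent ≤ b
    spent≤b = ≤-trans (+-mono-≤ (within-budget atU) (within-budget atV)) a+a≤b

    rest : Greedy (λ _ _ → ⊤) (b ∸ spent) B₃
    rest = greedy (λ _ _ → ⊤) (λ _ _ → yes tt) (b ∸ spent) B₃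

    B₄ : Board n
    B₄ = result rest

    B₁⊑B₂ : B₁ ⊑ B₂
    B₁⊑B₂ = claims-⊑ wf₁ (claims atU)

    B₂⊑B₃ : B₂ ⊑ B₃
    B₂⊑B₃ = claims-⊑ wf₂ (claims atV)

    B₃⊑B₄ : B₃ ⊑ B₄
    B₃⊑B₄ = claims-⊑ wf₃ (claims rest)

    B₁⊑B₄ : B₁ ⊑ B₄
    B₁⊑B₄ = ⊑-trans B₁⊑B₂ (⊑-trans B₂⊑B₃ B₃⊑B₄)

    safe₄ : ∀ x → Dec (Touches x u v) → Safe B₄ x
    safe₄ x (yes (inj₁ refl)) =
      safe-⊑ (⊑-trans B₂⊑B₃ B₃⊑B₄) (restore-safe u wf₁ (endpoint-potential (inj₁ refl)) atU)
    safe₄ x (yes (inj₂ refl)) =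
      safe-⊑ B₃⊑B₄
        (restore-safe v wf₂ (≤-trans (potential-⊑ B₁⊑B₂ v) (endpoint-potential (inj₂ refl))) atV)
    safe₄ x (no away) = safe-⊑ B₁⊑B₄ (safe-elsewhere away)

    invariant₄ : Invariant B₄
    invariant₄ = record
      { wellFormed = claims-wellFormed wf₃ (claims rest)
      ; capped     = λ x → subst (_≤ K) (sym (maker-≡ B₁⊑B₄ x)) (capped₁ x)
      ; safe       = λ x → safe₄ x (touches? x u v)
      }

    freeTotal-decreases : freeTotal B₄ < freeTotal B
    freeTotal-decreases = ≤-<-trans (sumᶠ-mono-≤ (free-≤ B₁⊑B₄))
      (sumᶠ-mono-< u free-≤₁ (≤-reflexive (trans (+-comm 1 _) (free-drop (inj₁ refl)))))

    reply : Reply B B₁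
    reply = spent + claimed rest , B₄
          , claims-++ (claims-++ (claims atU) (claims atV)) (claims rest)
          , subst (spent + claimed rest ≤_) (m+[n∸m]≡n spent≤b) (+-monoʳ-≤ spent (within-budget rest))
          , Sum.map (λ eq → trans (cong (spent +_) eq) (m+[n∸m]≡n spent≤b))
                    (λ none u v u<v → none u v u<v tt)
                    (exhausted rest)
          , invariant₄
          , freeTotal-decreases

  strategy : ∀ s (B : Board n) → freeTotal B < s → Invariant B → BreakerWins n (suc K) b B
  strategy zero    B ()    _
  strategy (suc s) B bound inv with FP.any? (λ u → FP.any? (λ v → (u F.<? v) ×-dec (B u v ≟O free)))
  ... | no none = done (λ u v u<v fr → none (u , v , u<v , fr)) maker-degree<1+K
    where
    maker-degree<1+K : MaxDegLess (suc K) B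
    maker-degree<1+K x =
      subst (_< suc K) (sym (length-filter-tabulate (B x) maker id)) (s≤s (Invariant.capped inv x))
  ... | yes edge = step edge (λ u v u<v fr → continue (MakerMove.reply inv u<v fr))
    where
    continue : ∀ {B₁} → Reply B B₁ → ∃ λ m → ∃ λ B′ →
      BreakerClaims B₁ m B′ × m ≤ b × (m ≡ b ⊎ Full B′) × BreakerWins n (suc K) b B′
    continue (m , B′ , cs , m≤b , used , inv′ , smaller) =
      m , B′ , cs , m≤b , used , strategy s B′ (<-≤-trans smaller (≤-pred bound)) inv′

  initial : Invariant (emptyBoard n)
  initial = record
    { wellFormed = record { symmetric = λ _ _ → refl ; diagonal-free = λ _ → refl }
    ; capped     = λ x → subst (_≤ K) (sym (no-maker-edge x)) z≤n
    ; safe       = λ x → inj₂ (≤-reflexive (initial-potential x))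
    }
    where
    no-maker-edge : ∀ x → degree (emptyBoard n) maker x ≡ 0
    no-maker-edge x = count-≡0 {n} (const free) maker (λ _ ())
    initial-potential : ∀ x → potential (emptyBoard n) x ≡ n
    initial-potential x = begin
      degree (emptyBoard n) free x + suc a * degree (emptyBoard n) maker x
        ≡⟨ cong₂ (λ f M → f + suc a * M) (count-const n free) (no-maker-edge x) ⟩
      n + suc a * 0  ≡⟨ cong (n +_) (*-zeroʳ (suc a)) ⟩
      n + 0          ≡⟨ +-identityʳ n ⟩
      n              ∎
      where open ≡-Reasoning

  win : BreakerWins n (suc K) b (emptyBoard n)
  win = strategy (suc (freeTotal (emptyBoard n))) (emptyBoard n) ≤-refl initial

⌊n/2⌋+⌊n/2⌋≤n : ∀ n → ⌊ n /2⌋ + ⌊ n /2⌋ ≤ n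
⌊n/2⌋+⌊n/2⌋≤n n = subst (⌊ n /2⌋ + ⌊ n /2⌋ ≤_) (⌊n/2⌋+⌈n/2⌉≡n n) (+-monoʳ-≤ ⌊ n /2⌋ (⌊n/2⌋≤⌈n/2⌉ n))

n≤2*[1+⌊n/2⌋] : ∀ n → n ≤ 2 * suc ⌊ n /2⌋
n≤2*[1+⌊n/2⌋] n = begin
  n                                  ≡⟨ ⌊n/2⌋+⌈n/2⌉≡n n ⟨
  ⌊ n /2⌋ + ⌈ n /2⌉                  ≤⟨ +-mono-≤ (n≤1+n ⌊ n /2⌋) (⌊n/2⌋-mono (n≤1+n (suc n))) ⟩
  suc ⌊ n /2⌋ + suc ⌊ n /2⌋          ≡⟨ cong (suc ⌊ n /2⌋ +_) (+-identityʳ (suc ⌊ n /2⌋)) ⟨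
  2 * suc ⌊ n /2⌋                    ∎
  where open ≤-Reasoning

n≤[1+⌊b/2⌋]*K : ∀ n b K → b * K ≡ 2 * n → n ≤ suc ⌊ b /2⌋ * K
n≤[1+⌊b/2⌋]*K n b K bK≡2n = *-cancelˡ-≤ 2 (begin
  2 * n                  ≡⟨ bK≡2n ⟨
  b * K                  ≤⟨ *-monoˡ-≤ K (n≤2*[1+⌊n/2⌋] b) ⟩
  2 * suc ⌊ b /2⌋ * K    ≡⟨ *-assoc 2 (suc ⌊ b /2⌋) K ⟩
  2 * (suc ⌊ b /2⌋ * K)  ∎)
  where open ≤-Reasoning

lemma5 : (n k b : ℕ) → k ≥ 2 → b * (k ∸ 1) ≡ 2 * n →
    BreakerWins n k b (emptyBoard n)
lemma5 n zero    b ()  _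
lemma5 n (suc K) b _ bK≡2n =
  BreakerStrategy.win n ⌊ b /2⌋ b K (⌊n/2⌋+⌊n/2⌋≤n b) (n≤[1+⌊b/2⌋]*K n b K bK≡2n)
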